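{- Let $TL_n$ be the triangular ladder. Then $\chi_g(TL_n)=6$ if $n\in\{3,4\}$, and $\chi_g(TL_n)=7$ if $n\geq 5$.
   Context: All graphs are finite, simple and connected. A graceful $k$-coloring of a non-empty graph $G$ ($k\geq 2$) is a proper vertex coloring $f:V(G)\to\{1,2,\dots,k\}$ such that the induced edge coloring $f^*(uv)=|f(u)-f(v)|$, with values in $\{1,\dots,k-1\}$, is a proper edge coloring. The graceful chromatic number $\chi_g(G)$ is the minimum such $k$. The triangular ladder $TL_n$ ($n\geq 2$) has vertex set $\{x_i,y_i:1\leq i\leq n\}$ and edge set $\{x_ix_{i+1},\,y_iy_{i+1},\,x_iy_{i+1}:1\leq i\leq n-1\}\cup\{x_iy_i:1\leq i\leq n\}$. -}

module Defs where

open import Level using (Level; suc; _⊔_)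
open import Data.Nat using (ℕ; _≤_; _<_; ∣_-_∣)
open import Data.Fin using (Fin; toℕ)
open import Data.Product using (_×_; ∃)
open import Data.Sum using (_⊎_)
open import Relation.Binary.PropositionalEquality using (_≡_; _≢_)
open import Relation.Nullary using (¬_)

record Graph : Set₁ where
  field
    V   : Set
    Adj : V → V → Set

open Graph public

IsGracefulColoring : (G : Graph) → ℕ → (V G → ℕ) → Set
IsGracefulColoring G k f =
    (∀ v → 1 ≤ f v × f v ≤ k)
  × (∀ u v → Adj G u v → f u ≢ f v)
  × (∀ u v w → Adj G u v → Adj G u w → v ≢ w → ∣ f u - f v ∣ ≢ ∣ f u - f w ∣)

HasGracefulColoring : Graph → ℕ → Set
HasGracefulColoring G k = ∃ λ (f : V G → ℕ) → IsGracefulColoring G k f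

GracefulChromaticNumberIs : Graph → ℕ → Set
GracefulChromaticNumberIs G k =
    2 ≤ k
  × HasGracefulColoring G k
  × (∀ j → 2 ≤ j → j < k → ¬ HasGracefulColoring G j)

-- Triangular ladder TL_n; indices are 0-based: x i, y i for i : Fin n.
data TLVertex (n : ℕ) : Set where
  x : Fin n → TLVertex n
  y : Fin n → TLVertex n

-- The listed (unordered) edges, each recorded in one orientation.
data TLEdge (n : ℕ) : TLVertex n → TLVertex n → Set where
  xx : (i j : Fin n) → toℕ j ≡ Data.Nat.suc (toℕ i) → TLEdge n (x i) (x j)
  yy : (i j : Fin n) → toℕ j ≡ Data.Nat.suc (toℕ i) → TLEdge n (y i) (y j)
  xy : (i j : Fin n) → toℕ j ≡ Data.Nat.suc (toℕ i) → TLEdge n (x i) (y j)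
  rung : (i : Fin n) → TLEdge n (x i) (y i)

TL : ℕ → Graph
TL n = record { V = TLVertex n ; Adj = λ u v → TLEdge n u v ⊎ TLEdge n v u }

-- Gracefulness is a condition on the star of each vertex: the neighbours avoid its color
-- and lie at pairwise distinct distances from it.  So it is decidable on finite graphs and
-- inherited by subgraphs.  The upper bounds are explicit colorings; for n ≥ 5 it is the
-- restriction of the period-3 coloring (1,3,6 on the x-rail, 5,7,2 on the y-rail) of the
-- infinite ladder.  The lower bounds are an exhaustive rung-by-rung extension of graceful
-- colorings, which dies out at TL₃ with 5 colors and at TL₅ with 6; every longer ladder
-- contains these.
module Submission where

open import Defs
open import Data.Nat using (ℕ; zero; suc; _≤_; z≤n; s≤s; ∣_-_∣; _+_; _≟_; _≤?_)
open import Data.Nat.Properties using (≤-refl; ≤-trans; ≤-pred; n≤1+n; +-suc; +-cancelˡ-≡)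
open import Data.Fin using (Fin; toℕ; inject≤)
import Data.Fin as Fin
open import Data.Fin.Properties using (toℕ-injective; toℕ-inject≤)
open import Data.List using (List; []; _∷_; _++_; map; filter; concatMap; applyUpTo; cartesianProduct; allFin)
open import Data.List.Properties using (map-∘)
open import Data.List.Membership.Propositional using (_∈_; lose)
open import Data.List.Membership.Propositional.Properties
  using ( ∈-map⁺; ∈-map⁻; ∈-++⁺ˡ; ∈-++⁺ʳ; ∈-allFin; ∈-filter⁺; ∈-filter⁻; ∈-concatMap⁺
        ; ∈-cartesianProduct⁺; ∈-applyUpTo⁺)
open import Data.List.Relation.Unary.All as All using (All)
import Data.List.Relation.Unary.All.Properties as All
open import Data.List.Relation.Unary.Any using (here; there)
open import Data.List.Relation.Unary.AllPairs using ([]; _∷_)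
open import Data.List.Relation.Unary.Unique.Propositional using (Unique)
import Data.List.Relation.Unary.Unique.Propositional.Properties as Unique
open import Data.List.Relation.Unary.Unique.DecPropositional _≟_ using (unique?)
open import Data.Vec using (Vec; []; _∷_; lookup; tabulate)
open import Data.Vec.Properties using (lookup∘tabulate)
open import Data.Product using (_×_; _,_; proj₁; proj₂; uncurry)
open import Data.Sum using (_⊎_; inj₁; inj₂)
import Data.Sum
open import Data.Empty using (⊥-elim)
open import Function using (_∘_)
open import Relation.Binary.PropositionalEquality using (_≡_; _≢_; refl; sym; trans; cong; cong₂; subst)
open import Relation.Nullary using (¬_; Dec; yes; no)
open import Relation.Nullary.Decidable using (map′; _×-dec_; _⊎-dec_; ¬?; from-yes; From-yes)

Unique-map⇒≢ : ∀ {A B : Set} {g : A → B} {xs : List A} {v w : A} →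
  Unique (map g xs) → v ∈ xs → w ∈ xs → v ≢ w → g v ≢ g w
Unique-map⇒≢ _ (here refl) (here refl) v≢w = λ _ → v≢w refl
Unique-map⇒≢ (gz∉ ∷ _) (here refl) (there w∈) _ = All.lookup (All.map⁻ gz∉) w∈
Unique-map⇒≢ (gz∉ ∷ _) (there v∈) (here refl) _ = All.lookup (All.map⁻ gz∉) v∈ ∘ sym
Unique-map⇒≢ (_ ∷ u) (there v∈) (there w∈) v≢w = Unique-map⇒≢ u v∈ w∈ v≢w

≢⇒Unique-map : ∀ {A B : Set} {g : A → B} {xs : List A} →
  (∀ {v w} → v ∈ xs → w ∈ xs → v ≢ w → g v ≢ g w) → Unique xs → Unique (map g xs)
≢⇒Unique-map _ [] = []
≢⇒Unique-map g-inj (z∉ ∷ u) =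
  All.map⁺ (All.tabulate (λ w∈ → g-inj (here refl) (there w∈) (All.lookup z∉ w∈)))
  ∷ ≢⇒Unique-map (λ v∈ w∈ → g-inj (there v∈) (there w∈)) u

GracefulStar : ℕ → List ℕ → Set
GracefulStar c cs = All (c ≢_) cs × Unique (map (λ d → ∣ c - d ∣) cs)

gracefulStar? : ∀ c cs → Dec (GracefulStar c cs)
gracefulStar? c cs = All.all? (λ d → ¬? (c ≟ d)) cs ×-dec unique? _

module _ {G : Graph} (nbrs : V G → List (V G)) where

  stars⇒graceful : (∀ {u v} → Adj G u v → v ∈ nbrs u) →
    ∀ {k f} → (∀ v → 1 ≤ f v × f v ≤ k) → (∀ u → GracefulStar (f u) (map f (nbrs u))) →
    IsGracefulColoring G k f
  stars⇒graceful complete {f = f} bounds stars = bounds , proper , distinct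
    where
    proper : ∀ u v → Adj G u v → f u ≢ f v
    proper u v uv = All.lookup (proj₁ (stars u)) (∈-map⁺ f (complete uv))
    distinct : ∀ u v w → Adj G u v → Adj G u w → v ≢ w → ∣ f u - f v ∣ ≢ ∣ f u - f w ∣
    distinct u v w uv uw =
      Unique-map⇒≢ (subst Unique (sym (map-∘ (nbrs u))) (proj₂ (stars u))) (complete uv) (complete uw)

  graceful⇒stars : (∀ {u v} → v ∈ nbrs u → Adj G u v) → (∀ u → Unique (nbrs u)) →
    ∀ {k f} → IsGracefulColoring G k f → ∀ u → GracefulStar (f u) (map f (nbrs u))
  graceful⇒stars sound unique (_ , proper , distinct) u =
    All.map⁺ (All.tabulate (λ v∈ → proper u _ (sound v∈))) ,
    subst Unique (map-∘ (nbrs u))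
      (≢⇒Unique-map (λ v∈ w∈ → distinct u _ _ (sound v∈) (sound w∈)) (unique u))

module FiniteGraph (G : Graph) (vertices : List (V G)) (∈-vertices : ∀ v → v ∈ vertices)
                   (vertices-unique : Unique vertices) (adj? : ∀ u v → Dec (Adj G u v)) where

  neighbours : V G → List (V G)
  neighbours u = filter (adj? u) vertices

  all-vertices? : ∀ {P : V G → Set} → (∀ v → Dec (P v)) → Dec (∀ v → P v)
  all-vertices? P? =
    map′ (λ ps v → All.lookup ps (∈-vertices v)) (λ ps → All.tabulate (λ {v} _ → ps v))
         (All.all? P? vertices)

  isGracefulColoring? : ∀ k f → Dec (IsGracefulColoring G k f)
  isGracefulColoring? k f =
    map′ (λ (bounds , stars) → stars⇒graceful neighbours complete bounds stars)
         (λ g → proj₁ g , graceful⇒stars neighbours sound unique g)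
         (all-vertices? (λ v → (1 ≤? f v) ×-dec (f v ≤? k))
          ×-dec all-vertices? (λ u → gracefulStar? (f u) (map f (neighbours u))))
    where
    complete : ∀ {u v} → Adj G u v → v ∈ neighbours u
    complete uv = ∈-filter⁺ (adj? _) (∈-vertices _) uv
    sound : ∀ {u v} → v ∈ neighbours u → Adj G u v
    sound {u} v∈ = proj₂ (∈-filter⁻ (adj? u) {xs = vertices} v∈)
    unique : ∀ u → Unique (neighbours u)
    unique u = Unique.filter⁺ (adj? u) vertices-unique

record _↪_ (H G : Graph) : Set where
  field
    embed     : V H → V G
    injective : ∀ {u v} → embed u ≡ embed v → u ≡ v
    adj       : ∀ {u v} → Adj H u v → Adj G (embed u) (embed v)

restrict : ∀ {H G k f} (e : H ↪ G) → IsGracefulColoring G k f →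
  IsGracefulColoring H k (f ∘ _↪_.embed e)
restrict e (bounds , proper , distinct) =
  bounds ∘ embed ,
  (λ u v → proper _ _ ∘ adj) ,
  (λ u v w uv uw v≢w → distinct _ _ _ (adj uv) (adj uw) (v≢w ∘ injective))
  where open _↪_ e

HasGracefulColoring-restrict : ∀ {H G k} → H ↪ G → HasGracefulColoring G k → HasGracefulColoring H k
HasGracefulColoring-restrict e (_ , g) = _ , restrict e g

HasGracefulColoring-mono : ∀ {G j k} → j ≤ k → HasGracefulColoring G j → HasGracefulColoring G k
HasGracefulColoring-mono j≤k (f , bounds , g) =
  f , (λ v → proj₁ (bounds v) , ≤-trans (proj₂ (bounds v)) j≤k) , g

IsGracefulColoring-cong : ∀ {G k f g} → (∀ v → f v ≡ g v) →
  IsGracefulColoring G k f → IsGracefulColoring G k g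
IsGracefulColoring-cong {f = f} {g} f≗g (bounds , proper , distinct) =
  (λ v → subst (λ c → 1 ≤ c × c ≤ _) (f≗g v) (bounds v)) ,
  (λ u v uv eq → proper u v uv (trans (f≗g u) (trans eq (sym (f≗g v))))) ,
  (λ u v w uv uw v≢w eq → distinct u v w uv uw v≢w
    (trans (dist-cong u v) (trans eq (sym (dist-cong u w)))))
  where
  dist-cong : ∀ u v → ∣ f u - f v ∣ ≡ ∣ g u - g v ∣
  dist-cong u v = cong₂ ∣_-_∣ (f≗g u) (f≗g v)

graceful-chromatic-number : ∀ {G k} → 2 ≤ suc k → HasGracefulColoring G (suc k) →
  ¬ HasGracefulColoring G k → GracefulChromaticNumberIs G (suc k)
graceful-chromatic-number 2≤1+k has ¬has =
  2≤1+k , has , λ j _ j<1+k → ¬has ∘ HasGracefulColoring-mono (≤-pred j<1+k)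

x-injective : ∀ {n} {i j : Fin n} → TLVertex.x i ≡ x j → i ≡ j
x-injective refl = refl

y-injective : ∀ {n} {i j : Fin n} → TLVertex.y i ≡ y j → i ≡ j
y-injective refl = refl

tlVertices : ∀ n → List (TLVertex n)
tlVertices n = map x (allFin n) ++ map y (allFin n)

∈-tlVertices : ∀ {n} (v : TLVertex n) → v ∈ tlVertices n
∈-tlVertices (x i) = ∈-++⁺ˡ (∈-map⁺ x (∈-allFin i))
∈-tlVertices {n} (y i) = ∈-++⁺ʳ (map x (allFin n)) (∈-map⁺ y (∈-allFin i))

tlVertices-unique : ∀ n → Unique (tlVertices n)
tlVertices-unique n =
  Unique.++⁺ (Unique.map⁺ x-injective (Unique.allFin⁺ n))
             (Unique.map⁺ y-injective (Unique.allFin⁺ n))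
             disjoint
  where
  disjoint : ∀ {v} → ¬ (v ∈ map x (allFin n) × v ∈ map y (allFin n))
  disjoint (v∈xs , v∈ys) with ∈-map⁻ x v∈xs | ∈-map⁻ y v∈ys
  ... | _ , _ , refl | _ , _ , ()

tlEdge? : ∀ {n} (u v : TLVertex n) → Dec (TLEdge n u v)
tlEdge? (x i) (x j) = map′ (xx i j) (λ { (xx _ _ p) → p }) (toℕ j ≟ suc (toℕ i))
tlEdge? (y i) (y j) = map′ (yy i j) (λ { (yy _ _ p) → p }) (toℕ j ≟ suc (toℕ i))
tlEdge? (y i) (x j) = no λ ()
tlEdge? (x i) (y j) with i Fin.≟ j
... | yes refl = yes (rung i)
... | no i≢j =
  map′ (xy i j) (λ { (xy _ _ p) → p ; (rung _) → ⊥-elim (i≢j refl) }) (toℕ j ≟ suc (toℕ i))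

tlAdj? : ∀ {n} (u v : TLVertex n) → Dec (Adj (TL n) u v)
tlAdj? u v = tlEdge? u v ⊎-dec tlEdge? v u

isGracefulColoring-TL? : ∀ n k f → Dec (IsGracefulColoring (TL n) k f)
isGracefulColoring-TL? n =
  FiniteGraph.isGracefulColoring? (TL n) (tlVertices n) ∈-tlVertices (tlVertices-unique n) tlAdj?

translation-↪ : ∀ {m n} (e : Fin m → Fin n) (c : ℕ) →
  (∀ i → toℕ (e i) ≡ c + toℕ i) → TL m ↪ TL n
translation-↪ {m} {n} e c toℕ-e = record { embed = embed ; injective = injective ; adj = Data.Sum.map edge edge }
  where
  embed : TLVertex m → TLVertex n
  embed (x i) = x (e i)
  embed (y i) = y (e i)

  e-injective : ∀ {i j} → e i ≡ e j → i ≡ j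
  e-injective {i} {j} eq =
    toℕ-injective (+-cancelˡ-≡ c _ _ (trans (sym (toℕ-e i)) (trans (cong toℕ eq) (toℕ-e j))))

  injective : ∀ {u v} → embed u ≡ embed v → u ≡ v
  injective {x i} {x j} eq = cong x (e-injective (x-injective eq))
  injective {y i} {y j} eq = cong y (e-injective (y-injective eq))
  injective {x i} {y j} ()
  injective {y i} {x j} ()

  e-suc : ∀ {i j} → toℕ j ≡ suc (toℕ i) → toℕ (e j) ≡ suc (toℕ (e i))
  e-suc {i} {j} p = trans (toℕ-e j) (trans (cong (c +_) p) (trans (+-suc c (toℕ i)) (cong suc (sym (toℕ-e i)))))

  edge : ∀ {u v} → TLEdge m u v → TLEdge n (embed u) (embed v)
  edge (xx i j p) = xx (e i) (e j) (e-suc p)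
  edge (yy i j p) = yy (e i) (e j) (e-suc p)
  edge (xy i j p) = xy (e i) (e j) (e-suc p)
  edge (rung i)   = rung (e i)

TL-↪-suc : ∀ {n} → TL n ↪ TL (suc n)
TL-↪-suc = translation-↪ Fin.suc 1 (λ _ → refl)

TL-↪-≤ : ∀ {m n} → m ≤ n → TL m ↪ TL n
TL-↪-≤ m≤n = translation-↪ (λ i → inject≤ i m≤n) 0 (λ i → toℕ-inject≤ i m≤n)

data TL∞Vertex : Set where
  x y : ℕ → TL∞Vertex

data TL∞Edge : TL∞Vertex → TL∞Vertex → Set where
  xx   : ∀ i j → j ≡ suc i → TL∞Edge (x i) (x j)
  yy   : ∀ i j → j ≡ suc i → TL∞Edge (y i) (y j)
  xy   : ∀ i j → j ≡ suc i → TL∞Edge (x i) (y j)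
  rung : ∀ i → TL∞Edge (x i) (y i)

x∞-injective : ∀ {i j} → TL∞Vertex.x i ≡ x j → i ≡ j
x∞-injective refl = refl

y∞-injective : ∀ {i j} → TL∞Vertex.y i ≡ y j → i ≡ j
y∞-injective refl = refl

TL∞ : Graph
TL∞ = record { V = TL∞Vertex ; Adj = λ u v → TL∞Edge u v ⊎ TL∞Edge v u }

TL-↪-TL∞ : ∀ {n} → TL n ↪ TL∞
TL-↪-TL∞ {n} = record { embed = embed ; injective = injective ; adj = Data.Sum.map edge edge }
  where
  embed : TLVertex n → TL∞Vertex
  embed (x i) = x (toℕ i)
  embed (y i) = y (toℕ i)

  injective : ∀ {u v} → embed u ≡ embed v → u ≡ v
  injective {x i} {x j} eq = cong x (toℕ-injective (x∞-injective eq))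
  injective {y i} {y j} eq = cong y (toℕ-injective (y∞-injective eq))
  injective {x i} {y j} ()
  injective {y i} {x j} ()

  edge : ∀ {u v} → TLEdge n u v → TL∞Edge (embed u) (embed v)
  edge (xx i j p) = xx (toℕ i) (toℕ j) p
  edge (yy i j p) = yy (toℕ i) (toℕ j) p
  edge (xy i j p) = xy (toℕ i) (toℕ j) p
  edge (rung i)   = rung (toℕ i)

neighbours∞ : TL∞Vertex → List TL∞Vertex
neighbours∞ (x zero)    = y zero ∷ x 1 ∷ y 1 ∷ []
neighbours∞ (x (suc i)) = y (suc i) ∷ x (suc (suc i)) ∷ y (suc (suc i)) ∷ x i ∷ []
neighbours∞ (y zero)    = x zero ∷ y 1 ∷ []
neighbours∞ (y (suc i)) = x (suc i) ∷ y (suc (suc i)) ∷ y i ∷ x i ∷ []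

∈-neighbours∞ : ∀ {u v} → Adj TL∞ u v → v ∈ neighbours∞ u
∈-neighbours∞ (inj₁ (xx zero _ refl))    = there (here refl)
∈-neighbours∞ (inj₁ (xx (suc _) _ refl)) = there (here refl)
∈-neighbours∞ (inj₁ (yy zero _ refl))    = there (here refl)
∈-neighbours∞ (inj₁ (yy (suc _) _ refl)) = there (here refl)
∈-neighbours∞ (inj₁ (xy zero _ refl))    = there (there (here refl))
∈-neighbours∞ (inj₁ (xy (suc _) _ refl)) = there (there (here refl))
∈-neighbours∞ (inj₁ (rung zero))         = here refl
∈-neighbours∞ (inj₁ (rung (suc _)))      = here refl
∈-neighbours∞ (inj₂ (xx _ _ refl))       = there (there (there (here refl)))
∈-neighbours∞ (inj₂ (yy _ _ refl))       = there (there (here refl))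
∈-neighbours∞ (inj₂ (xy _ _ refl))       = there (there (there (here refl)))
∈-neighbours∞ (inj₂ (rung zero))         = here refl
∈-neighbours∞ (inj₂ (rung (suc _)))      = here refl

periodic-coloring : TL∞Vertex → ℕ
periodic-coloring (x 0) = 1
periodic-coloring (x 1) = 3
periodic-coloring (x 2) = 6
periodic-coloring (x (suc (suc (suc i)))) = periodic-coloring (x i)
periodic-coloring (y 0) = 5
periodic-coloring (y 1) = 7
periodic-coloring (y 2) = 2
periodic-coloring (y (suc (suc (suc i)))) = periodic-coloring (y i)

periodic-coloring-graceful : IsGracefulColoring TL∞ 7 periodic-coloring
periodic-coloring-graceful = stars⇒graceful neighbours∞ ∈-neighbours∞ bounds stars
  where
  f = periodic-coloring

  bound : ∀ v → From-yes ((1 ≤? f v) ×-dec (f v ≤? 7))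
  bound v = from-yes ((1 ≤? f v) ×-dec (f v ≤? 7))

  bounds : ∀ v → 1 ≤ f v × f v ≤ 7
  bounds (x 0) = bound (x 0)
  bounds (x 1) = bound (x 1)
  bounds (x 2) = bound (x 2)
  bounds (x (suc (suc (suc i)))) = bounds (x i)
  bounds (y 0) = bound (y 0)
  bounds (y 1) = bound (y 1)
  bounds (y 2) = bound (y 2)
  bounds (y (suc (suc (suc i)))) = bounds (y i)

  star : ∀ u → From-yes (gracefulStar? (f u) (map f (neighbours∞ u)))
  star u = from-yes (gracefulStar? (f u) (map f (neighbours∞ u)))

  stars : ∀ u → GracefulStar (f u) (map f (neighbours∞ u))
  stars (x 0) = star (x 0)
  stars (x 1) = star (x 1)
  stars (x 2) = star (x 2)
  stars (x 3) = star (x 3)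
  stars (x (suc (suc (suc (suc i))))) = stars (x (suc i))
  stars (y 0) = star (y 0)
  stars (y 1) = star (y 1)
  stars (y 2) = star (y 2)
  stars (y 3) = star (y 3)
  stars (y (suc (suc (suc (suc i))))) = stars (y (suc i))

coloring : ∀ {n} → Vec (ℕ × ℕ) n → TLVertex n → ℕ
coloring rs (x i) = proj₁ (lookup rs i)
coloring rs (y i) = proj₂ (lookup rs i)

rungs : ∀ {n} → (TLVertex n → ℕ) → Vec (ℕ × ℕ) n
rungs f = tabulate (λ i → f (x i) , f (y i))

coloring-rungs : ∀ {n} (f : TLVertex n → ℕ) v → f v ≡ coloring (rungs f) v
coloring-rungs f (x i) = sym (cong proj₁ (lookup∘tabulate _ i))
coloring-rungs f (y i) = sym (cong proj₂ (lookup∘tabulate _ i))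

colors : ℕ → List ℕ
colors k = applyUpTo suc k

∈-colors : ∀ {c k} → 1 ≤ c → c ≤ k → c ∈ colors k
∈-colors (s≤s z≤n) c≤k = ∈-applyUpTo⁺ suc c≤k

extensions : ∀ {n} → ℕ → Vec (ℕ × ℕ) n → List (Vec (ℕ × ℕ) (suc n))
extensions k rs = map (_∷ rs) (cartesianProduct (colors k) (colors k))

-- Since TL n is the last n rungs of TL (suc n), every graceful k-coloring of TL (suc n)
-- extends one of TL n by a new first rung (rungs∈gracefulRungs).
gracefulRungs : (k n : ℕ) → List (Vec (ℕ × ℕ) n)
gracefulRungs k zero    = [] ∷ []
gracefulRungs k (suc n) =
  filter (λ rs → isGracefulColoring-TL? (suc n) k (coloring rs))
    (concatMap (extensions k) (gracefulRungs k n))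

rungs∈gracefulRungs : ∀ {n k f} → IsGracefulColoring (TL n) k f → rungs f ∈ gracefulRungs k n
rungs∈gracefulRungs {zero} _ = here refl
rungs∈gracefulRungs {suc n} {k} {f} g@(bounds , _) =
  ∈-filter⁺ (λ rs → isGracefulColoring-TL? (suc n) k (coloring rs))
    (∈-concatMap⁺ (extensions k) (lose (rungs∈gracefulRungs (restrict TL-↪-suc g)) first-rung))
    (IsGracefulColoring-cong (coloring-rungs f) g)
  where
  first-rung : rungs f ∈ extensions k (rungs (f ∘ _↪_.embed TL-↪-suc))
  first-rung = ∈-map⁺ _ (∈-cartesianProduct⁺ (uncurry ∈-colors (bounds (x Fin.zero)))
                                              (uncurry ∈-colors (bounds (y Fin.zero))))

no-graceful-coloring : ∀ {n k} → gracefulRungs k n ≡ [] → ¬ HasGracefulColoring (TL n) k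
no-graceful-coloring none (f , g) with () ← subst (rungs f ∈_) none (rungs∈gracefulRungs g)

TL-not-5-colorable : ∀ {n} → 3 ≤ n → ¬ HasGracefulColoring (TL n) 5
TL-not-5-colorable 3≤n = no-graceful-coloring {3} refl ∘ HasGracefulColoring-restrict (TL-↪-≤ 3≤n)

TL-not-6-colorable : ∀ {n} → 5 ≤ n → ¬ HasGracefulColoring (TL n) 6
TL-not-6-colorable 5≤n = no-graceful-coloring {5} refl ∘ HasGracefulColoring-restrict (TL-↪-≤ 5≤n)

TL₃-coloring : TLVertex 3 → ℕ
TL₃-coloring = coloring ((1 , 2) ∷ (5 , 6) ∷ (2 , 3) ∷ [])

TL₄-coloring : TLVertex 4 → ℕ
TL₄-coloring = coloring ((3 , 2) ∷ (6 , 5) ∷ (2 , 1) ∷ (5 , 4) ∷ [])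

TL₃-coloring-graceful : IsGracefulColoring (TL 3) 6 TL₃-coloring
TL₃-coloring-graceful = from-yes (isGracefulColoring-TL? 3 6 TL₃-coloring)

TL₄-coloring-graceful : IsGracefulColoring (TL 4) 6 TL₄-coloring
TL₄-coloring-graceful = from-yes (isGracefulColoring-TL? 4 6 TL₄-coloring)

theorem3p5 : (n : ℕ)
    → ((n ≡ 3 ⊎ n ≡ 4) → GracefulChromaticNumberIs (TL n) 6)
    × (5 ≤ n → GracefulChromaticNumberIs (TL n) 7)
theorem3p5 n = χg≡6 , χg≡7
  where
  χg≡6 : (n ≡ 3 ⊎ n ≡ 4) → GracefulChromaticNumberIs (TL n) 6
  χg≡6 (inj₁ refl) = graceful-chromatic-number (s≤s (s≤s z≤n))
    (_ , TL₃-coloring-graceful) (TL-not-5-colorable ≤-refl)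
  χg≡6 (inj₂ refl) = graceful-chromatic-number (s≤s (s≤s z≤n))
    (_ , TL₄-coloring-graceful) (TL-not-5-colorable (n≤1+n 3))

  χg≡7 : 5 ≤ n → GracefulChromaticNumberIs (TL n) 7
  χg≡7 5≤n = graceful-chromatic-number (s≤s (s≤s z≤n))
    (_ , restrict TL-↪-TL∞ periodic-coloring-graceful) (TL-not-6-colorable 5≤n)
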